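{- Let $n\ge 2$ and $k\ge 1$ be natural numbers. There exists a function $R^n_k:[\omega]^n\to k$ with the $(n,k)$-star property.
   Context: A function $c:[\omega]^n\to k$ has the $(n,k)$-star property if for every pairwise disjoint finite sets $A_0,A_1,\dots,A_{k-1}\subseteq[\omega]^{n-1}$ there exists $j\in\omega\setminus\bigcup_{i<k}\bigcup A_i$ such that for every $i<k$ and every $\{j_2,\dots,j_n\}\in A_i$ we have $c(\{j,j_2,\dots,j_n\})=i$. -}

module Defs where

open import Data.Nat using (ℕ; _<_; _≤_; _∸_)
open import Data.Fin as Fin using (Fin)
open import Data.Vec using (Vec; lookup)
open import Data.List using (List)
open import Data.List.Membership.Propositional using (_∈_)
open import Data.Product using (Σ; ∃; _×_; _,_)
open import Data.Sum using (_⊎_)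
open import Data.Empty using (⊥)
open import Relation.Nullary using (¬_)
open import Relation.Binary.PropositionalEquality using (_≡_; _≢_)
open import Function.Bundles using (_⇔_)

-- [ω]^m : the m-element subsets of ω = ℕ, represented canonically by their
-- strictly increasing enumeration (the monotonicity proof is irrelevant).
record [ω]^ (m : ℕ) : Set where
  constructor mkSet
  field
    elems      : Vec ℕ m
    .increasing : ∀ (i j : Fin m) → i Fin.< j → lookup elems i < lookup elems j
open [ω]^ public

_∈ₛ_ : ∀ {m} → ℕ → [ω]^ m → Set
_∈ₛ_ {m} x s = Σ (Fin m) (λ i → lookup (elems s) i ≡ x)

_∈⋃_ : ∀ {m} → ℕ → List ([ω]^ m) → Set
x ∈⋃ A = ∃ λ s → s ∈ A × x ∈ₛ s

IsInsert : ∀ {m n} → ℕ → [ω]^ m → [ω]^ n → Set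
IsInsert j s t = ∀ x → (x ∈ₛ t) ⇔ (x ≡ j ⊎ x ∈ₛ s)

StarProperty : (n k : ℕ) → ([ω]^ n → Fin k) → Set
StarProperty n k c =
  (A : Fin k → List ([ω]^ (n ∸ 1))) →
  (∀ (i i' : Fin k) → i ≢ i' → ∀ s → s ∈ A i → s ∈ A i' → ⊥) →
  ∃ λ (j : ℕ) →
    (∀ (i : Fin k) → ¬ (j ∈⋃ A i)) ×
    (∀ (i : Fin k) (s : [ω]^ (n ∸ 1)) → s ∈ A i →
       ∀ (t : [ω]^ n) → IsInsert j s t → c t ≡ i)

-- Every finite colouring pattern can be written into a single natural number
-- as a lookup table keyed by codes of (n-1)-sets.  Colour an n-set by reading
-- the table coded by its maximum and looking up the rest of the set.  Given
-- disjoint A₀, …, A_{k-1}, take j to be the code of the table sending each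
-- s ∈ Aᵢ to i: the code of a table exceeds every number occurring in it, so
-- j lies above ⋃ Aᵢ, and for s ∈ Aᵢ the set {j} ∪ s has maximum j and
-- colour i.
module Submission where

open import Defs
open import Data.Nat using (ℕ; _≤_)
open import Data.Fin using (Fin)
open import Data.Product using (Σ)

open import Data.Nat using (zero; suc; _+_; _<_; z<s; s<s; _<?_; _≟_)
open import Data.Nat.Properties
  using (≤-trans; <-trans; <-≤-trans; <-irrefl; ≤-antisym; <⇒≤; ≤-refl; m≤m+n; m≤n+m; m<m+n; +-suc; +-identityʳ)
open import Data.Nat.DivMod using (_mod_; m<n⇒m%n≡m)
open import Data.Nat.Binary as ℕᵇ using (ℕᵇ; 2[1+_]; 1+[2_])
open import Data.Nat.Binary.Properties using (fromℕ-toℕ)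
open import Data.Fin as Fin using (toℕ)
open import Data.Fin.Properties using (toℕ-injective; toℕ-fromℕ<; toℕ<n)
open import Data.Vec as Vec using (Vec; []; _∷_; _∷ʳ_; toList; init; last)
open import Data.Vec.Properties using (toList-injective; cast-is-id; init-∷ʳ; last-∷ʳ)
open import Data.Vec.Relation.Unary.All as All using (All; []; _∷_)
open import Data.Vec.Relation.Unary.All.Properties using (lookup⁻)
open import Data.Vec.Relation.Unary.AllPairs using (AllPairs; []; _∷_; allPairs?)
open import Data.Vec.Relation.Unary.Any using (here; there; index)
open import Data.Vec.Relation.Unary.Any.Properties using (lookup-index)
open import Data.Vec.Membership.Propositional renaming (_∈_ to _∈ᵛ_)
open import Data.Vec.Membership.Propositional.Properties using (∈-lookup; ∈-toList⁺)
open import Data.List using (List; []; _∷_; concatMap; map; allFin)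
open import Data.List.Relation.Unary.Any as Any using (here; there)
open import Data.List.Membership.Propositional using (_∈_)
open import Data.List.Membership.Propositional.Properties
  using (∈-map⁺; ∈-map⁻; ∈-concatMap⁺; ∈-concatMap⁻; ∈-allFin)
open import Data.Product using (∃₂; _×_; _,_)
open import Data.Sum as Sum using (_⊎_; inj₁; inj₂)
open import Data.Empty using (⊥; ⊥-elim)
open import Function using (_∘_; Equivalence)
open import Relation.Nullary using (¬_; yes; no)
open import Relation.Nullary.Decidable using (recompute)
open import Relation.Binary.PropositionalEquality
  using (_≡_; _≢_; refl; sym; trans; cong; cong₂; module ≡-Reasoning)

-- The list a₀ ∷ a₁ ∷ … is coded in bijective base 2 (digits 1 and 2, least
-- significant first) by a₀ digits 1, a digit 2, a₁ digits 1, a digit 2, ….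

ones : ℕ → ℕᵇ → ℕᵇ
ones zero    y = y
ones (suc a) y = 1+[2 ones a y ]

encodeᵇ : List ℕ → ℕᵇ
encodeᵇ []      = ℕᵇ.zero
encodeᵇ (a ∷ l) = ones a 2[1+ encodeᵇ l ]

-- The first argument counts the digits 1 read since the last digit 2.
decodeᵇ : ℕ → ℕᵇ → List ℕ
decodeᵇ a ℕᵇ.zero  = []
decodeᵇ a 1+[2 x ] = decodeᵇ (suc a) x
decodeᵇ a 2[1+ x ] = a ∷ decodeᵇ 0 x

decodeᵇ-ones : ∀ a b y → decodeᵇ b (ones a y) ≡ decodeᵇ (a + b) y
decodeᵇ-ones zero    b y = refl
decodeᵇ-ones (suc a) b y = trans (decodeᵇ-ones a (suc b) y) (cong (λ c → decodeᵇ c y) (+-suc a b))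

decodeᵇ-encodeᵇ : ∀ l → decodeᵇ 0 (encodeᵇ l) ≡ l
decodeᵇ-encodeᵇ []      = refl
decodeᵇ-encodeᵇ (a ∷ l) = begin
  decodeᵇ 0 (ones a 2[1+ encodeᵇ l ])  ≡⟨ decodeᵇ-ones a 0 _ ⟩
  decodeᵇ (a + 0) 2[1+ encodeᵇ l ]     ≡⟨ cong (λ c → c ∷ decodeᵇ 0 (encodeᵇ l)) (+-identityʳ a) ⟩
  a ∷ decodeᵇ 0 (encodeᵇ l)            ≡⟨ cong (a ∷_) (decodeᵇ-encodeᵇ l) ⟩
  a ∷ l                                ∎
  where open ≡-Reasoning

toℕ-ones : ∀ a y → a + ℕᵇ.toℕ y ≤ ℕᵇ.toℕ (ones a y)
toℕ-ones zero    y = ≤-refl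
toℕ-ones (suc a) y = s<s (≤-trans (toℕ-ones a y) (m≤m+n _ _))

encode : List ℕ → ℕ
encode = ℕᵇ.toℕ ∘ encodeᵇ

decode : ℕ → List ℕ
decode = decodeᵇ 0 ∘ ℕᵇ.fromℕ

decode-encode : ∀ l → decode (encode l) ≡ l
decode-encode l = trans (cong (decodeᵇ 0) (fromℕ-toℕ (encodeᵇ l))) (decodeᵇ-encodeᵇ l)

encode-injective : ∀ {l l′} → encode l ≡ encode l′ → l ≡ l′
encode-injective {l} {l′} eq =
  trans (sym (decode-encode l)) (trans (cong decode eq) (decode-encode l′))

head<encode : ∀ a l → a < encode (a ∷ l)
head<encode a l = <-≤-trans (m<m+n a z<s) (toℕ-ones a _)

encode<encode-∷ : ∀ a l → encode l < encode (a ∷ l)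
encode<encode-∷ a l = ≤-trans (m≤m+n _ _) (≤-trans (m≤n+m _ a) (toℕ-ones a _))

∈⇒<encode : ∀ {x l} → x ∈ l → x < encode l
∈⇒<encode {l = a ∷ l} (here refl) = head<encode a l
∈⇒<encode {l = a ∷ l} (there x∈l) = <-trans (∈⇒<encode x∈l) (encode<encode-∷ a l)

Table : Set
Table = List (ℕ × ℕ)

flatten : Table → List ℕ
flatten []            = []
flatten ((a , b) ∷ T) = a ∷ b ∷ flatten T

pairUp : List ℕ → Table
pairUp []          = []
pairUp (a ∷ [])    = []
pairUp (a ∷ b ∷ l) = (a , b) ∷ pairUp l

pairUp-flatten : ∀ T → pairUp (flatten T) ≡ T
pairUp-flatten []            = refl
pairUp-flatten ((a , b) ∷ T) = cong ((a , b) ∷_) (pairUp-flatten T)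

encodeTable : Table → ℕ
encodeTable = encode ∘ flatten

decodeTable : ℕ → Table
decodeTable = pairUp ∘ decode

decodeTable-encodeTable : ∀ T → decodeTable (encodeTable T) ≡ T
decodeTable-encodeTable T = trans (cong pairUp (decode-encode (flatten T))) (pairUp-flatten T)

key∈flatten : ∀ {x v T} → (x , v) ∈ T → x ∈ flatten T
key∈flatten (here refl) = here refl
key∈flatten (there p)   = there (there (key∈flatten p))

key<encodeTable : ∀ {x v T} → (x , v) ∈ T → x < encodeTable T
key<encodeTable = ∈⇒<encode ∘ key∈flatten

lookupKey : Table → ℕ → ℕ
lookupKey []            x = 0
lookupKey ((y , v) ∷ T) x with y ≟ x
... | yes _ = v
... | no  _ = lookupKey T x

lookupKey-unique : ∀ T {x w} → (∀ {v} → (x , v) ∈ T → v ≡ w) → (x , w) ∈ T → lookupKey T x ≡ w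
lookupKey-unique ((y , v) ∷ T) {x} unique x∈T with y ≟ x
... | yes refl = unique (here refl)
... | no  y≢x with x∈T
...   | here refl = ⊥-elim (y≢x refl)
...   | there p   = lookupKey-unique T (unique ∘ there) p

code : ∀ {r} → Vec ℕ r → ℕ
code = encode ∘ toList

code-injective : ∀ {r} {u v : Vec ℕ r} → code u ≡ code v → u ≡ v
code-injective {u = u} {v} eq =
  trans (sym (cast-is-id refl u)) (toList-injective refl u v (encode-injective eq))

∈⇒<code : ∀ {r x} {u : Vec ℕ r} → x ∈ᵛ u → x < code u
∈⇒<code = ∈⇒<encode ∘ ∈-toList⁺

Increasing : ∀ {r} → Vec ℕ r → Set
Increasing = AllPairs _<_

lookup-increasing⇒Increasing : ∀ {r} (u : Vec ℕ r) →
  (∀ i j → i Fin.< j → Vec.lookup u i < Vec.lookup u j) → Increasing u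
lookup-increasing⇒Increasing []      inc = []
lookup-increasing⇒Increasing (x ∷ u) inc =
  lookup⁻ (λ i → inc Fin.zero (Fin.suc i) z<s) ∷
  lookup-increasing⇒Increasing u (λ i j i<j → inc (Fin.suc i) (Fin.suc j) (s<s i<j))

elems-increasing : ∀ {r} (s : [ω]^ r) → Increasing (elems s)
elems-increasing (mkSet u u↑) = recompute (allPairs? _<?_ u) (lookup-increasing⇒Increasing u u↑)

elems-injective : ∀ {r} {s s′ : [ω]^ r} → elems s ≡ elems s′ → s ≡ s′
elems-injective {s = mkSet u _} {mkSet .u _} refl = refl

∈ₛ⇒∈ : ∀ {r x} (s : [ω]^ r) → x ∈ₛ s → x ∈ᵛ elems s
∈ₛ⇒∈ s (i , refl) = ∈-lookup i (elems s)

∈⇒∈ₛ : ∀ {r x} (s : [ω]^ r) → x ∈ᵛ elems s → x ∈ₛ s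
∈⇒∈ₛ s x∈ = index x∈ , sym (lookup-index x∈)

head-≤ : ∀ {r x y} {u : Vec ℕ r} → Increasing (x ∷ u) → y ∈ᵛ x ∷ u → x ≤ y
head-≤ _           (here refl) = ≤-refl
head-≤ (x<u ∷ _)   (there y∈u) = <⇒≤ (All.lookup x<u y∈u)

increasing-unique : ∀ {r} {u v : Vec ℕ r} → Increasing u → Increasing v →
  (∀ {x} → x ∈ᵛ u → x ∈ᵛ v) → (∀ {x} → x ∈ᵛ v → x ∈ᵛ u) → u ≡ v
increasing-unique [] [] _ _ = refl
increasing-unique u↑@(a<u ∷ u′↑) v↑@(b<v ∷ v′↑) u⊆v v⊆u =
  cong₂ _∷_ a≡b (increasing-unique u′↑ v′↑ (tail⊆ a≡b a<u (u⊆v ∘ there)) (tail⊆ (sym a≡b) b<v (v⊆u ∘ there)))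
  where
  a≡b = ≤-antisym (head-≤ u↑ (v⊆u (here refl))) (head-≤ v↑ (u⊆v (here refl)))
  tail⊆ : ∀ {n m a b} {u : Vec ℕ n} {v : Vec ℕ m} → a ≡ b → All (a <_) u →
    (∀ {x} → x ∈ᵛ u → x ∈ᵛ b ∷ v) → ∀ {x} → x ∈ᵛ u → x ∈ᵛ v
  tail⊆ refl a<u sub x∈u with sub x∈u
  ... | here refl = ⊥-elim (<-irrefl refl (All.lookup a<u x∈u))
  ... | there x∈v = x∈v

All-∷ʳ : ∀ {P : ℕ → Set} {r y} {u : Vec ℕ r} → All P u → P y → All P (u ∷ʳ y)
All-∷ʳ []         py = py ∷ []
All-∷ʳ (px ∷ pu) py = px ∷ All-∷ʳ pu py

∷ʳ-increasing : ∀ {r y} {u : Vec ℕ r} → Increasing u → All (_< y) u → Increasing (u ∷ʳ y)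
∷ʳ-increasing []           []          = [] ∷ []
∷ʳ-increasing (x<u ∷ u↑) (x<y ∷ u<y) = All-∷ʳ x<u x<y ∷ ∷ʳ-increasing u↑ u<y

∈-∷ʳ⁺ : ∀ {r x y} (u : Vec ℕ r) → x ≡ y ⊎ x ∈ᵛ u → x ∈ᵛ u ∷ʳ y
∈-∷ʳ⁺ []      (inj₁ refl)        = here refl
∈-∷ʳ⁺ (z ∷ u) (inj₁ x≡y)         = there (∈-∷ʳ⁺ u (inj₁ x≡y))
∈-∷ʳ⁺ (z ∷ u) (inj₂ (here x≡z))  = here x≡z
∈-∷ʳ⁺ (z ∷ u) (inj₂ (there x∈u)) = there (∈-∷ʳ⁺ u (inj₂ x∈u))

∈-∷ʳ⁻ : ∀ {r x y} (u : Vec ℕ r) → x ∈ᵛ u ∷ʳ y → x ≡ y ⊎ x ∈ᵛ u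
∈-∷ʳ⁻ []      (here x≡y)  = inj₁ x≡y
∈-∷ʳ⁻ (z ∷ u) (here x≡z)  = inj₂ (here x≡z)
∈-∷ʳ⁻ (z ∷ u) (there x∈) = Sum.map₂ there (∈-∷ʳ⁻ u x∈)

IsInsert⇒elems≡∷ʳ : ∀ {r j} (s : [ω]^ r) (t : [ω]^ (suc r)) →
  All (_< j) (elems s) → IsInsert j s t → elems t ≡ elems s ∷ʳ j
IsInsert⇒elems≡∷ʳ {j = j} s t s<j t≈j∪s =
  increasing-unique (elems-increasing t) (∷ʳ-increasing (elems-increasing s) s<j) t⊆ ⊆t
  where
  t⊆ : ∀ {x} → x ∈ᵛ elems t → x ∈ᵛ elems s ∷ʳ j
  t⊆ {x} x∈t = ∈-∷ʳ⁺ (elems s) (Sum.map₂ (∈ₛ⇒∈ s) (Equivalence.to (t≈j∪s x) (∈⇒∈ₛ t x∈t)))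
  ⊆t : ∀ {x} → x ∈ᵛ elems s ∷ʳ j → x ∈ᵛ elems t
  ⊆t {x} x∈ = ∈ₛ⇒∈ t (Equivalence.from (t≈j∪s x) (Sum.map₂ (∈⇒∈ₛ s) (∈-∷ʳ⁻ (elems s) x∈)))

toℕ-mod : ∀ {k} (i : Fin (suc k)) → toℕ i mod suc k ≡ i
toℕ-mod i = toℕ-injective (trans (toℕ-fromℕ< _) (m<n⇒m%n≡m (toℕ<n i)))

starColouring : ∀ {r k} → [ω]^ (suc r) → Fin (suc k)
starColouring {k = k} t = lookupKey (decodeTable (last (elems t))) (code (init (elems t))) mod suc k

starColouring-∷ʳ : ∀ {r k j} {u : Vec ℕ r} (t : [ω]^ (suc r)) → elems t ≡ u ∷ʳ j →
  starColouring {k = k} t ≡ lookupKey (decodeTable j) (code u) mod suc k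
starColouring-∷ʳ {j = j} {u} t eq rewrite eq | last-∷ʳ j u | init-∷ʳ j u = refl

PairwiseDisjoint : ∀ {k} {X : Set} → (Fin k → List X) → Set
PairwiseDisjoint A = ∀ i i′ → i ≢ i′ → ∀ s → s ∈ A i → s ∈ A i′ → ⊥

entries : ∀ {r k} → (Fin k → List ([ω]^ r)) → Fin k → Table
entries A i = map (λ s → code (elems s) , toℕ i) (A i)

tableOf : ∀ {r k} → (Fin k → List ([ω]^ r)) → Table
tableOf {k = k} A = concatMap (entries A) (allFin k)

∈-tableOf⁺ : ∀ {r k} (A : Fin k → List ([ω]^ r)) {i s} → s ∈ A i → (code (elems s) , toℕ i) ∈ tableOf A
∈-tableOf⁺ A {i} s∈ = ∈-concatMap⁺ (entries A) (Any.map (λ { refl → ∈-map⁺ _ s∈ }) (∈-allFin i))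

∈-tableOf⁻ : ∀ {r k} (A : Fin k → List ([ω]^ r)) {x v} → (x , v) ∈ tableOf A →
  ∃₂ λ i s → s ∈ A i × x ≡ code (elems s) × v ≡ toℕ i
∈-tableOf⁻ {k = k} A e∈ with Any.satisfied (∈-concatMap⁻ (entries A) {xs = allFin k} e∈)
... | i , e∈entries with ∈-map⁻ (λ s → code (elems s) , toℕ i) e∈entries
...   | s , s∈ , refl = i , s , s∈ , refl , refl

tableOf-functional : ∀ {r k} {A : Fin k → List ([ω]^ r)} {i s v} → PairwiseDisjoint A →
  s ∈ A i → (code (elems s) , v) ∈ tableOf A → v ≡ toℕ i
tableOf-functional {A = A} {i} {s} disjoint s∈ e∈ with ∈-tableOf⁻ A e∈
... | i′ , s′ , s′∈ , code≡ , refl with elems-injective {s = s} {s′} (code-injective code≡)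
...   | refl with i Fin.≟ i′
...     | yes refl = refl
...     | no  i≢i′ = ⊥-elim (disjoint i i′ i≢i′ s s∈ s′∈)

star : ∀ {r k} → StarProperty (suc r) (suc k) starColouring
star {r} {k} A disjoint = j , j∉⋃A , colour-of-insert
  where
  T : Table
  T = tableOf A
  j : ℕ
  j = encodeTable T
  below-j : ∀ {i s x} → s ∈ A i → x ∈ᵛ elems s → x < j
  below-j s∈ x∈ = <-trans (∈⇒<code x∈) (key<encodeTable (∈-tableOf⁺ A s∈))
  j∉⋃A : ∀ i → ¬ (j ∈⋃ A i)
  j∉⋃A i (s , s∈ , j∈s) = <-irrefl refl (below-j s∈ (∈ₛ⇒∈ s j∈s))
  colour-of-insert : ∀ i s → s ∈ A i → ∀ t → IsInsert j s t → starColouring t ≡ i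
  colour-of-insert i s s∈ t t≈j∪s = begin
    starColouring t
      ≡⟨ starColouring-∷ʳ t (IsInsert⇒elems≡∷ʳ s t s<j t≈j∪s) ⟩
    lookupKey (decodeTable j) (code (elems s)) mod suc k
      ≡⟨ cong (λ T′ → lookupKey T′ (code (elems s)) mod suc k) (decodeTable-encodeTable T) ⟩
    lookupKey T (code (elems s)) mod suc k
      ≡⟨ cong (_mod suc k) (lookupKey-unique T (tableOf-functional disjoint s∈) (∈-tableOf⁺ A s∈)) ⟩
    toℕ i mod suc k
      ≡⟨ toℕ-mod i ⟩
    i ∎
    where
    open ≡-Reasoning
    s<j : All (_< j) (elems s)
    s<j = lookup⁻ (λ ix → below-j s∈ (∈-lookup ix (elems s)))

proposition2p1 : (n k : ℕ) → 2 ≤ n → 1 ≤ k →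
    Σ ([ω]^ n → Fin k) (λ c → StarProperty n k c)
proposition2p1 zero    k       ()  _
proposition2p1 (suc n) zero    _   ()
proposition2p1 (suc n) (suc k) _   _  = starColouring , star
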